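{- Let $K$ be a field with $\operatorname{char}K\neq2$, and let $P,Q\in K[X,Y]$ be relatively prime homogeneous polynomials of degree $2$, with homogeneous differential $D=D_{P,Q}=c(\theta_1X-\eta_1Y)(\theta_2X-\eta_2Y)$ where $c\in K^\times$ and $[\eta_i:\theta_i]\in\mathbb{P}^1(\overline K)$. Let $F=(P,Q)$, let $s_0,t_0\in K$ not both zero, and for $n\ge0$ let $H_n:=t_0P_n-s_0Q_n$ where $(P_n,Q_n)=F^n$. Suppose there is an integer $\ell\geq1$ such that $F^\ell([\eta_1:\theta_1])=F^\ell([\eta_2:\theta_2])$ as points of $\mathbb{P}^1(\overline K)$ but $F^{\ell-1}([\eta_1:\theta_1])\neq F^{\ell-1}([\eta_2:\theta_2])$. Then $\ell\geq2$, and \[\operatorname{Res}(P,Q)\prod_{i=1}^2H_\ell(\eta_i,\theta_i)\in K^2\quad\text{and}\quad\prod_{i=1}^2H_n(\eta_i,\theta_i)\in K^2\ \text{ for every } n\geq\ell+1,\] where $K^2$ denotes the set of squares of elements of $K$.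
   Context: $F^n$ denotes $n$-fold composition of $(X,Y)\mapsto(P,Q)$, with $F^0=(X,Y)$; it also acts on $\mathbb{P}^1(\overline K)$. For homogeneous $P=\prod_{i}(b_iX-a_iY)$, $Q=\prod_j(d_jX-c_jY)$ over $\overline K$ (pairs not both zero), $\operatorname{Res}(P,Q)=\prod_{i,j}(a_id_j-b_ic_j)$. The homogeneous differential is $D_{P,Q}=\frac1Y(P_XQ-PQ_X)$, with formal partial derivatives. -}

module Defs where

open import Level using (Level; _⊔_) renaming (suc to lsuc)
open import Data.Nat using (ℕ; zero; suc)
open import Data.Product using (_×_; _,_; ∃; Σ)
open import Relation.Nullary using (¬_)
open import Algebra.Bundles using (CommutativeRing)
open import Algebra.Morphism.Structures using (module RingMorphisms)

record Field (c ℓ : Level) : Set (lsuc (c ⊔ ℓ)) where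
  field
    commutativeRing : CommutativeRing c ℓ
  open CommutativeRing commutativeRing public
  field
    0≉1     : ¬ (0# ≈ 1#)
    inverse : ∀ x → ¬ (x ≈ 0#) → ∃ λ y → x * y ≈ 1#

record FieldExtension {c ℓ} (K : Field c ℓ) (c′ ℓ′ : Level)
       : Set (lsuc (c ⊔ ℓ ⊔ c′ ⊔ ℓ′)) where
  field
    L  : Field c′ ℓ′
    ι  : Field.Carrier K → Field.Carrier L
    isRingMonomorphism :
      RingMorphisms.IsRingMonomorphism (Field.rawRing K) (Field.rawRing L) ι

-- Binary forms over a commutative ring.
-- A pair (x , y) is a point / vector (X , Y).
-- A quadratic form is a triple (f₀ , f₁ , f₂) standing for
--   f₀ X² + f₁ X Y + f₂ Y².

module _ {c ℓ : Level} (R : CommutativeRing c ℓ) where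
  open CommutativeRing R

  Pt : Set c
  Pt = Carrier × Carrier

  Form : Set c
  Form = Carrier × Carrier × Carrier

  NonZeroPt : Pt → Set ℓ
  NonZeroPt (x , y) = ¬ ((x ≈ 0#) × (y ≈ 0#))

  NonZeroForm : Form → Set ℓ
  NonZeroForm (f₀ , f₁ , f₂) = ¬ ((f₀ ≈ 0#) × (f₁ ≈ 0#) × (f₂ ≈ 0#))

  _≈F_ : Form → Form → Set ℓ
  (f₀ , f₁ , f₂) ≈F (g₀ , g₁ , g₂) = (f₀ ≈ g₀) × (f₁ ≈ g₁) × (f₂ ≈ g₂)

  evalF : Form → Pt → Carrier
  evalF (f₀ , f₁ , f₂) (x , y) = f₀ * x * x + f₁ * x * y + f₂ * y * y

  scaleF : Carrier → Form → Form
  scaleF k (f₀ , f₁ , f₂) = (k * f₀ , k * f₁ , k * f₂)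

  linMul : Pt → Pt → Form
  linMul (u₁ , v₁) (u₂ , v₂) = (u₁ * u₂ , u₁ * v₂ + v₁ * u₂ , v₁ * v₂)

  -- the linear form  b X - a Y  vanishing at the point [a : b]
  linOf : Pt → Pt
  linOf (a , b) = (b , - a)

  linProd : Pt → Pt → Form
  linProd r s = linMul (linOf r) (linOf s)

  -- Res(P,Q) = ∏_{i,j} (aᵢ dⱼ - bᵢ cⱼ) for P = ∏ (bᵢ X - aᵢ Y),
  -- Q = ∏ (dⱼ X - cⱼ Y); here rᵢ = (aᵢ , bᵢ), sⱼ = (cⱼ , dⱼ).
  resTerm : Pt → Pt → Carrier
  resTerm (a , b) (c′ , d) = a * d - b * c′

  Res : Pt → Pt → Pt → Pt → Carrier
  Res r₁ r₂ s₁ s₂ =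
    resTerm r₁ s₁ * resTerm r₁ s₂ * resTerm r₂ s₁ * resTerm r₂ s₂

  -- Homogeneous differential D_{P,Q} = (1/Y)(P_X Q - P Q_X).
  -- With P = p₀X² + p₁XY + p₂Y², Q = q₀X² + q₁XY + q₂Y² one has
  --   P_X Q - P Q_X = (p₀q₁ - p₁q₀) X²Y + 2(p₀q₂ - p₂q₀) XY² + (p₁q₂ - p₂q₁) Y³,
  -- hence:
  Dform : Form → Form → Form
  Dform (p₀ , p₁ , p₂) (q₀ , q₁ , q₂) =
    ( p₀ * q₁ - p₁ * q₀
    , (1# + 1#) * (p₀ * q₂ - p₂ * q₀)
    , p₁ * q₂ - p₂ * q₁ )

  Fmap : Form → Form → Pt → Pt
  Fmap P Q z = (evalF P z , evalF Q z)

  Fiter : Form → Form → ℕ → Pt → Pt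
  Fiter P Q zero    z = z
  Fiter P Q (suc n) z = Fmap P Q (Fiter P Q n z)

  Hn : Form → Form → Carrier → Carrier → ℕ → Pt → Carrier
  Hn P Q s₀ t₀ n z with Fiter P Q n z
  ... | (x , y) = t₀ * x - s₀ * y

  ProjEq : Pt → Pt → Set ℓ
  ProjEq (x₁ , y₁) (x₂ , y₂) = x₁ * y₂ ≈ x₂ * y₁

  -- Relative primality of two quadratic forms in R[X,Y]: no common
  -- non-unit divisor.  A non-unit divisor of a nonzero binary quadratic
  -- form is a homogeneous form of degree 1 or 2; degree-1 common divisors
  -- are common linear factors, degree-2 common divisors g give P = k₁ g,
  -- Q = k₂ g.
  CommonLinearFactor : Form → Form → Set (c ⊔ ℓ)
  CommonLinearFactor P Q =
    Σ Pt λ l → NonZeroPt l × (∃ λ m₁ → ∃ λ m₂ →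
      (P ≈F linMul l m₁) × (Q ≈F linMul l m₂))

  CommonQuadraticFactor : Form → Form → Set (c ⊔ ℓ)
  CommonQuadraticFactor P Q =
    Σ Form λ g → NonZeroForm g × (∃ λ k₁ → ∃ λ k₂ →
      (P ≈F scaleF k₁ g) × (Q ≈F scaleF k₂ g))

  RelativelyPrime : Form → Form → Set (c ⊔ ℓ)
  RelativelyPrime P Q = ¬ CommonLinearFactor P Q × ¬ CommonQuadraticFactor P Q

module _ {c ℓ c′ ℓ′} {K : Field c ℓ} (E : FieldExtension K c′ ℓ′) where
  open FieldExtension E
  private
    module K = Field K
    module L = Field L

  ιF : Form K.commutativeRing → Form L.commutativeRing
  ιF (f₀ , f₁ , f₂) = (ι f₀ , ι f₁ , ι f₂)

  InKSquares : L.Carrier → Set (c ⊔ ℓ′)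
  InKSquares x = ∃ λ (k : K.Carrier) → ι (k K.* k) L.≈ x

{-# OPTIONS --safe #-}
-- Write B_h for the polarisation of a binary quadratic form h, so that
-- B_h(u , v)² = 4 h(u) h(v) + disc(h) det(u , v)², and G for the Gram matrix of D = D_{P,Q}, so that
-- P(u) Q(v) - Q(u) P(v) = det(u , v) G(u , v).  For h with coefficients in K, B_h(u , v) is a
-- K-linear combination of the entries of the symmetric tensor u ⊙ v = (u₁v₁ , u₁v₂ + u₂v₁ , u₂v₂).
-- For the roots e₁ , e₂ of D these entries are coefficients of D / c, and the entries of
-- F(u) ⊙ F(v) are polynomials over K in those of u ⊙ v, so every F^n(e₁) ⊙ F^n(e₂) is K-rational.
-- Put h = t₀ P - s₀ Q, so that H_(n+1) = h ∘ F^n.  For n > ℓ the points u = F^(n-1)(e₁) and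
-- v = F^(n-1)(e₂) are proportional, so H_n(e₁) H_n(e₂) = h(u) h(v) = (B_h(u , v) / 2)² is a square.
-- For n = ℓ they are not, but F(u) and F(v) are, so G(u , v) = 0: then u is proportional to
-- w = adj(G) v, h(w) = Res(P , Q) h(v), and B_h(u , w) is again a K-linear combination of the
-- entries of u ⊙ v.  Finally ℓ = 1 is impossible: 2 G(e₁ , e₂) = - c det(e₁ , e₂)² ≠ 0.

module Submission where

open import Defs
open import Level using (Level; _⊔_)
open import Algebra.Bundles using (CommutativeRing)
open import Algebra.Morphism.Structures using (module RingMorphisms)
import Algebra.Solver.Ring.AlmostCommutativeRing as ACR
open import Data.Maybe using (Maybe; just; nothing)
open import Data.Nat as ℕ using (ℕ; zero; suc; _≤_; _∸_; z≤n; s≤s; _≤′_; ≤′-reflexive; ≤′-step)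
open import Data.Empty using (⊥-elim)
import Data.Nat.Properties as ℕ
open import Data.Integer as ℤ using (ℤ; +_; -[1+_]; _⊖_; _◃_; sign; ∣_∣)
import Data.Integer.Properties as ℤ
open import Data.Sign as Sign using (Sign)
open import Data.Product using (_×_; _,_; ∃; proj₁; proj₂)
open import Data.Vec using (Vec; []; _∷_; map; allFin)
open import Data.Vec.N-ary using (N-ary; _$ⁿ_)
open import Data.Vec.Relation.Unary.All using (All; []; _∷_)
open import Data.Vec.Relation.Unary.All.Properties using (lookup⁺)
open import Function using (id; _∘_)
open import Relation.Nullary using (¬_; yes; no)
import Relation.Binary.PropositionalEquality as ≡

module IntegerCoefficients {c ℓ} (R : CommutativeRing c ℓ) where
  open CommutativeRing R
  open import Algebra.Properties.Semiring.Mult.TCOptimised semiring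
    using (×-homo-+; ×1-homo-*; 1+×) renaming (_×_ to _×ₙ_)
  open import Algebra.Properties.Ring ring using (-1*x≈-x)
  open import Algebra.Properties.AbelianGroup +-abelianGroup using (⁻¹-∙-comm)
  open import Algebra.Properties.Group +-group using (ε⁻¹≈ε; ⁻¹-involutive)
  open import Algebra.Properties.CommutativeSemigroup +-commutativeSemigroup
    using () renaming (interchange to +-interchange)
  open import Algebra.Properties.CommutativeSemigroup *-commutativeSemigroup
    using () renaming (interchange to *-interchange)
  open import Relation.Binary.Reasoning.Setoid setoid

  -- The optimised multiple makes ⟦ + 1 ⟧ℤ reduce to 1#, so a formula instantiated at
  -- polynomialRing below evaluates back to the same formula even when it mentions two.
  ⟦_⟧ℤ : ℤ → Carrier
  ⟦ + n ⟧ℤ      = n ×ₙ 1#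
  ⟦ -[1+ n ] ⟧ℤ = - (suc n ×ₙ 1#)

  ⟦_⟧± : Sign → Carrier
  ⟦ Sign.+ ⟧± = 1#
  ⟦ Sign.- ⟧± = - 1#

  ◃-homo : ∀ s n → ⟦ s ◃ n ⟧ℤ ≈ ⟦ s ⟧± * (n ×ₙ 1#)
  ◃-homo s      zero    = sym (zeroʳ _)
  ◃-homo Sign.+ (suc n) = sym (*-identityˡ _)
  ◃-homo Sign.- (suc n) = sym (-1*x≈-x _)

  sign-*-homo : ∀ s t → ⟦ s Sign.* t ⟧± ≈ ⟦ s ⟧± * ⟦ t ⟧±
  sign-*-homo Sign.+ t      = sym (*-identityˡ _)
  sign-*-homo Sign.- Sign.+ = sym (*-identityʳ _)
  sign-*-homo Sign.- Sign.- = sym (trans (-1*x≈-x _) (⁻¹-involutive _))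

  ⟦⟧ℤ-signAbs : ∀ i → ⟦ i ⟧ℤ ≈ ⟦ sign i ⟧± * (∣ i ∣ ×ₙ 1#)
  ⟦⟧ℤ-signAbs i = trans (reflexive (≡.cong ⟦_⟧ℤ (≡.sym (ℤ.◃-inverse i)))) (◃-homo (sign i) ∣ i ∣)

  *-homo : ∀ i j → ⟦ i ℤ.* j ⟧ℤ ≈ ⟦ i ⟧ℤ * ⟦ j ⟧ℤ
  *-homo i j = begin
    ⟦ (sign i Sign.* sign j) ◃ (∣ i ∣ ℕ.* ∣ j ∣) ⟧ℤ
      ≈⟨ ◃-homo (sign i Sign.* sign j) (∣ i ∣ ℕ.* ∣ j ∣) ⟩
    ⟦ sign i Sign.* sign j ⟧± * ((∣ i ∣ ℕ.* ∣ j ∣) ×ₙ 1#)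
      ≈⟨ *-cong (sign-*-homo (sign i) (sign j)) (×1-homo-* ∣ i ∣ ∣ j ∣) ⟩
    (⟦ sign i ⟧± * ⟦ sign j ⟧±) * ((∣ i ∣ ×ₙ 1#) * (∣ j ∣ ×ₙ 1#))
      ≈⟨ *-interchange _ _ _ _ ⟩
    (⟦ sign i ⟧± * (∣ i ∣ ×ₙ 1#)) * (⟦ sign j ⟧± * (∣ j ∣ ×ₙ 1#))
      ≈⟨ *-cong (⟦⟧ℤ-signAbs i) (⟦⟧ℤ-signAbs j) ⟨
    ⟦ i ⟧ℤ * ⟦ j ⟧ℤ ∎

  ⊖-homo : ∀ m n → ⟦ m ⊖ n ⟧ℤ ≈ m ×ₙ 1# - n ×ₙ 1#
  ⊖-homo m       zero    = sym (trans (+-congˡ ε⁻¹≈ε) (+-identityʳ _))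
  ⊖-homo zero    (suc n) = sym (+-identityˡ _)
  ⊖-homo (suc m) (suc n) = begin
    ⟦ suc m ⊖ suc n ⟧ℤ                   ≡⟨ ≡.cong ⟦_⟧ℤ (ℤ.[1+m]⊖[1+n]≡m⊖n m n) ⟩
    ⟦ m ⊖ n ⟧ℤ                           ≈⟨ ⊖-homo m n ⟩
    m ×ₙ 1# - n ×ₙ 1#                    ≈⟨ +-identityˡ _ ⟨
    0# + (m ×ₙ 1# - n ×ₙ 1#)             ≈⟨ +-congʳ (-‿inverseʳ 1#) ⟨
    (1# - 1#) + (m ×ₙ 1# - n ×ₙ 1#)      ≈⟨ +-interchange _ _ _ _ ⟩
    (1# + m ×ₙ 1#) + (- 1# - n ×ₙ 1#)    ≈⟨ +-congˡ (⁻¹-∙-comm 1# _) ⟩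
    (1# + m ×ₙ 1#) - (1# + n ×ₙ 1#)      ≈⟨ +-cong (1+× m 1#) (-‿cong (1+× n 1#)) ⟨
    suc m ×ₙ 1# - suc n ×ₙ 1#            ∎

  +-homo : ∀ i j → ⟦ i ℤ.+ j ⟧ℤ ≈ ⟦ i ⟧ℤ + ⟦ j ⟧ℤ
  +-homo (+ m)    (+ n)    = ×-homo-+ 1# m n
  +-homo (+ m)    -[1+ n ] = ⊖-homo m (suc n)
  +-homo -[1+ m ] (+ n)    = trans (⊖-homo n (suc m)) (+-comm _ _)
  +-homo -[1+ m ] -[1+ n ] = begin
    - (suc (suc (m ℕ.+ n)) ×ₙ 1#)     ≡⟨ ≡.cong (λ k → - (suc k ×ₙ 1#)) (ℕ.+-suc m n) ⟨
    - ((suc m ℕ.+ suc n) ×ₙ 1#)       ≈⟨ -‿cong (×-homo-+ 1# (suc m) (suc n)) ⟩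
    - (suc m ×ₙ 1# + suc n ×ₙ 1#)     ≈⟨ ⁻¹-∙-comm _ _ ⟨
    - (suc m ×ₙ 1#) - suc n ×ₙ 1#     ∎

  -‿homo : ∀ i → ⟦ ℤ.- i ⟧ℤ ≈ - ⟦ i ⟧ℤ
  -‿homo (+ zero)  = sym ε⁻¹≈ε
  -‿homo (+ suc n) = refl
  -‿homo -[1+ n ]  = sym (⁻¹-involutive _)

  ℤ-morphism : ℤ.+-*-rawRing ACR.-Raw-AlmostCommutative⟶ ACR.fromCommutativeRing R
  ℤ-morphism = record
    { ⟦_⟧ = ⟦_⟧ℤ ; +-homo = +-homo ; *-homo = *-homo ; -‿homo = -‿homo
    ; 0-homo = refl ; 1-homo = refl }

  _≟ℤ_ : ∀ i j → Maybe (⟦ i ⟧ℤ ≈ ⟦ j ⟧ℤ)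
  i ≟ℤ j with i ℤ.≟ j
  ... | yes ≡.refl = just refl
  ... | no _       = nothing

  open import Algebra.Solver.Ring ℤ.+-*-rawRing (ACR.fromCommutativeRing R) ℤ-morphism _≟ℤ_
    public using (Polynomial; op; [+]; [*]; con; var; _:^_; :-_; _:+_; _:*_; _:-_; ⟦_⟧; solve; _:=_)

  -- Formulas are written once over an arbitrary commutative ring; instantiated at this
  -- ring of polynomials (up to equal evaluations) they become input for the solver.
  polynomialRing : ℕ → CommutativeRing _ _
  polynomialRing n = record
    { Carrier = Polynomial n
    ; _≈_ = λ p q → ∀ ρ → ⟦ p ⟧ ρ ≈ ⟦ q ⟧ ρ
    ; _+_ = _:+_ ; _*_ = _:*_ ; -_ = :-_ ; 0# = con (+ 0) ; 1# = con (+ 1)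
    ; isCommutativeRing = record
      { isRing = record
        { +-isAbelianGroup = record
          { isGroup = record
            { isMonoid = record
              { isSemigroup = record
                { isMagma = record
                  { isEquivalence = record
                    { refl = λ _ → refl ; sym = λ p ρ → sym (p ρ) ; trans = λ p q ρ → trans (p ρ) (q ρ) }
                  ; ∙-cong = λ p q ρ → +-cong (p ρ) (q ρ) }
                ; assoc = λ _ _ _ _ → +-assoc _ _ _ }
              ; identity = (λ _ _ → +-identityˡ _) , (λ _ _ → +-identityʳ _) }
            ; inverse = (λ _ _ → -‿inverseˡ _) , (λ _ _ → -‿inverseʳ _)
            ; ⁻¹-cong = λ p ρ → -‿cong (p ρ) }
          ; comm = λ _ _ _ → +-comm _ _ }
        ; *-cong = λ p q ρ → *-cong (p ρ) (q ρ)
        ; *-assoc = λ _ _ _ _ → *-assoc _ _ _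
        ; *-identity = (λ _ _ → *-identityˡ _) , (λ _ _ → *-identityʳ _)
        ; distrib = (λ _ _ _ _ → distribˡ _ _ _) , (λ _ _ _ _ → distribʳ _ _ _) }
      ; *-comm = λ _ _ _ → *-comm _ _ } }

  close : ∀ n → N-ary n (Polynomial n) (Polynomial n) → Polynomial n
  close n f = f $ⁿ map var (allFin n)

  module _ {p} {Pr : Carrier → Set p}
           (0∈ : Pr 0#) (1∈ : Pr 1#)
           (+∈ : ∀ {x y} → Pr x → Pr y → Pr (x + y))
           (*∈ : ∀ {x y} → Pr x → Pr y → Pr (x * y))
           (-∈ : ∀ {x} → Pr x → Pr (- x)) where

    ×ₙ1-closed : ∀ n → Pr (n ×ₙ 1#)
    ×ₙ1-closed 0             = 0∈
    ×ₙ1-closed 1             = 1∈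
    ×ₙ1-closed (suc (suc n)) = +∈ (×ₙ1-closed (suc n)) 1∈

    ⟦⟧ℤ-closed : ∀ i → Pr ⟦ i ⟧ℤ
    ⟦⟧ℤ-closed (+ n)      = ×ₙ1-closed n
    ⟦⟧ℤ-closed -[1+ n ]   = -∈ (×ₙ1-closed (suc n))

    ⟦⟧-closed : ∀ {n} (p : Polynomial n) {ρ} → All Pr ρ → Pr (⟦ p ⟧ ρ)
    ⟦⟧-closed (op [+] p q) ρ∈ = +∈ (⟦⟧-closed p ρ∈) (⟦⟧-closed q ρ∈)
    ⟦⟧-closed (op [*] p q) ρ∈ = *∈ (⟦⟧-closed p ρ∈) (⟦⟧-closed q ρ∈)
    ⟦⟧-closed (con i)      ρ∈ = ⟦⟧ℤ-closed i
    ⟦⟧-closed (var x)      ρ∈ = lookup⁺ ρ∈ x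
    ⟦⟧-closed (p :^ k) {ρ} ρ∈ = ^-closed k
      where
      ^-closed : ∀ k → Pr (⟦ p :^ k ⟧ ρ)
      ^-closed zero    = 1∈
      ^-closed (suc k) = *∈ (⟦⟧-closed p ρ∈) (^-closed k)
    ⟦⟧-closed (:- p)       ρ∈ = -∈ (⟦⟧-closed p ρ∈)

module _ {c ℓ} (R : CommutativeRing c ℓ) where
  open CommutativeRing R

  -- A triple (g₀ , g₁ , g₂) is read either as the Gram matrix [[g₀ , g₁] , [g₁ , g₂]]
  -- of a symmetric bilinear form, or as a symmetric tensor; pairing is the duality.
  Triple : Set c
  Triple = Carrier × Carrier × Carrier

  two : Carrier
  two = 1# + 1#

  det : Pt R → Pt R → Carrier
  det (u₁ , u₂) (v₁ , v₂) = u₁ * v₂ - u₂ * v₁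

  symTensor : Pt R → Pt R → Triple
  symTensor (u₁ , u₂) (v₁ , v₂) = (u₁ * v₁ , u₁ * v₂ + u₂ * v₁ , u₂ * v₂)

  pairing : Triple → Triple → Carrier
  pairing (g₀ , g₁ , g₂) (a , m , b) = g₀ * a + g₁ * m + g₂ * b

  bilinear : Triple → Pt R → Pt R → Carrier
  bilinear g u v = pairing g (symTensor u v)

  polarGram : Form R → Triple
  polarGram (f₀ , f₁ , f₂) = (two * f₀ , f₁ , two * f₂)

  disc : Form R → Carrier
  disc (f₀ , f₁ , f₂) = f₁ * f₁ - two * two * (f₀ * f₂)

  -- The Gram matrix of D_{P,Q}: Dform P Q is (g₀ , two * g₁ , g₂) for g = diffGram P Q.
  diffGram : Form R → Form R → Triple
  diffGram (p₀ , p₁ , p₂) (q₀ , q₁ , q₂) =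
    (p₀ * q₁ - p₁ * q₀ , p₀ * q₂ - p₂ * q₀ , p₁ * q₂ - p₂ * q₁)

  gramDisc : Triple → Carrier
  gramDisc (g₀ , g₁ , g₂) = g₁ * g₁ - g₀ * g₂

  adjugate : Triple → Pt R → Pt R
  adjugate (g₀ , g₁ , g₂) (v₁ , v₂) = (- (g₁ * v₁ + g₂ * v₂) , g₀ * v₁ + g₁ * v₂)

  pencil : Carrier → Carrier → Form R → Form R → Form R
  pencil s t (p₀ , p₁ , p₂) (q₀ , q₁ , q₂) = (t * p₀ - s * q₀ , t * p₁ - s * q₁ , t * p₂ - s * q₂)

  twistGram : Form R → Triple → Triple
  twistGram (h₀ , h₁ , h₂) (g₀ , g₁ , g₂) =
    (h₁ * g₀ - two * h₀ * g₁ , h₁ * g₁ - two * h₀ * g₂ , two * h₂ * g₁ - h₁ * g₂)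

  productOnTensor : Form R → Triple → Carrier
  productOnTensor (f₀ , f₁ , f₂) (a , m , b) =
    f₀ * f₀ * (a * a) + f₂ * f₂ * (b * b) + f₁ * f₁ * (a * b)
    + f₀ * f₂ * (m * m - two * (a * b)) + f₀ * f₁ * (a * m) + f₁ * f₂ * (b * m)

  productSumOnTensor : Form R → Form R → Triple → Carrier
  productSumOnTensor (f₀ , f₁ , f₂) (g₀ , g₁ , g₂) (a , m , b) =
    two * (f₀ * g₀ * (a * a) + f₂ * g₂ * (b * b) + f₁ * g₁ * (a * b))
    + (f₀ * g₂ + f₂ * g₀) * (m * m - two * (a * b))
    + (f₀ * g₁ + f₁ * g₀) * (a * m) + (f₁ * g₂ + f₂ * g₁) * (b * m)

  symTensorMap : Form R → Form R → Triple → Triple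
  symTensorMap P Q t = (productOnTensor P t , productSumOnTensor P Q t , productOnTensor Q t)

module _ {c ℓ} (R : CommutativeRing c ℓ) where
  open CommutativeRing R
  open IntegerCoefficients R using (polynomialRing; solve; _:=_; _:+_; _:*_; _:-_; :-_)

  det-Fmap : ∀ P Q u v →
    det R (Fmap R P Q u) (Fmap R P Q v) ≈ det R u v * bilinear R (diffGram R P Q) u v
  det-Fmap (p₀ , p₁ , p₂) (q₀ , q₁ , q₂) (u₁ , u₂) (v₁ , v₂) = solve 10
    (λ p₀ p₁ p₂ q₀ q₁ q₂ u₁ u₂ v₁ v₂ →
      let ℙ = polynomialRing 10; P = (p₀ , p₁ , p₂); Q = (q₀ , q₁ , q₂); u = (u₁ , u₂); v = (v₁ , v₂) in
      det ℙ (Fmap ℙ P Q u) (Fmap ℙ P Q v) := det ℙ u v :* bilinear ℙ (diffGram ℙ P Q) u v)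
    refl p₀ p₁ p₂ q₀ q₁ q₂ u₁ u₂ v₁ v₂

  symTensor-Fmap : ∀ P Q u v →
    _≈F_ R (symTensor R (Fmap R P Q u) (Fmap R P Q v)) (symTensorMap R P Q (symTensor R u v))
  symTensor-Fmap (p₀ , p₁ , p₂) (q₀ , q₁ , q₂) (u₁ , u₂) (v₁ , v₂) =
      solve 7 (λ p₀ p₁ p₂ u₁ u₂ v₁ v₂ →
        let ℙ = polynomialRing 7; P = (p₀ , p₁ , p₂); u = (u₁ , u₂); v = (v₁ , v₂) in
        evalF ℙ P u :* evalF ℙ P v := productOnTensor ℙ P (symTensor ℙ u v))
        refl p₀ p₁ p₂ u₁ u₂ v₁ v₂
    , solve 10 (λ p₀ p₁ p₂ q₀ q₁ q₂ u₁ u₂ v₁ v₂ →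
        let ℙ = polynomialRing 10; P = (p₀ , p₁ , p₂); Q = (q₀ , q₁ , q₂); u = (u₁ , u₂); v = (v₁ , v₂) in
        evalF ℙ P u :* evalF ℙ Q v :+ evalF ℙ Q u :* evalF ℙ P v
          := productSumOnTensor ℙ P Q (symTensor ℙ u v))
        refl p₀ p₁ p₂ q₀ q₁ q₂ u₁ u₂ v₁ v₂
    , solve 7 (λ q₀ q₁ q₂ u₁ u₂ v₁ v₂ →
        let ℙ = polynomialRing 7; Q = (q₀ , q₁ , q₂); u = (u₁ , u₂); v = (v₁ , v₂) in
        evalF ℙ Q u :* evalF ℙ Q v := productOnTensor ℙ Q (symTensor ℙ u v))
        refl q₀ q₁ q₂ u₁ u₂ v₁ v₂

  bilinear-polarGram² : ∀ h u v →
    bilinear R (polarGram R h) u v * bilinear R (polarGram R h) u v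
      ≈ two R * two R * (evalF R h u * evalF R h v) + disc R h * (det R u v * det R u v)
  bilinear-polarGram² (h₀ , h₁ , h₂) (u₁ , u₂) (v₁ , v₂) = solve 7
    (λ h₀ h₁ h₂ u₁ u₂ v₁ v₂ →
      let ℙ = polynomialRing 7; h = (h₀ , h₁ , h₂); u = (u₁ , u₂); v = (v₁ , v₂) in
      bilinear ℙ (polarGram ℙ h) u v :* bilinear ℙ (polarGram ℙ h) u v
        := two ℙ :* two ℙ :* (evalF ℙ h u :* evalF ℙ h v) :+ disc ℙ h :* (det ℙ u v :* det ℙ u v))
    refl h₀ h₁ h₂ u₁ u₂ v₁ v₂

  det-adjugate : ∀ g u v → det R u (adjugate R g v) ≈ bilinear R g u v
  det-adjugate (g₀ , g₁ , g₂) (u₁ , u₂) (v₁ , v₂) = solve 7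
    (λ g₀ g₁ g₂ u₁ u₂ v₁ v₂ →
      let ℙ = polynomialRing 7; g = (g₀ , g₁ , g₂); u = (u₁ , u₂); v = (v₁ , v₂) in
      det ℙ u (adjugate ℙ g v) := bilinear ℙ g u v)
    refl g₀ g₁ g₂ u₁ u₂ v₁ v₂

  evalF-pencil : ∀ s t P Q z → evalF R (pencil R s t P Q) z ≈ t * evalF R P z - s * evalF R Q z
  evalF-pencil s t (p₀ , p₁ , p₂) (q₀ , q₁ , q₂) (z₁ , z₂) = solve 10
    (λ s t p₀ p₁ p₂ q₀ q₁ q₂ z₁ z₂ →
      let ℙ = polynomialRing 10; P = (p₀ , p₁ , p₂); Q = (q₀ , q₁ , q₂); z = (z₁ , z₂) in
      evalF ℙ (pencil ℙ s t P Q) z := t :* evalF ℙ P z :- s :* evalF ℙ Q z)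
    refl s t p₀ p₁ p₂ q₀ q₁ q₂ z₁ z₂

  evalF-pencil-adjugate : ∀ s t P Q v →
    evalF R (pencil R s t P Q) (adjugate R (diffGram R P Q) v)
      ≈ gramDisc R (diffGram R P Q) * evalF R (pencil R s t P Q) v
  evalF-pencil-adjugate s t (p₀ , p₁ , p₂) (q₀ , q₁ , q₂) (v₁ , v₂) = solve 10
    (λ s t p₀ p₁ p₂ q₀ q₁ q₂ v₁ v₂ →
      let ℙ = polynomialRing 10; P = (p₀ , p₁ , p₂); Q = (q₀ , q₁ , q₂); v = (v₁ , v₂) in
      evalF ℙ (pencil ℙ s t P Q) (adjugate ℙ (diffGram ℙ P Q) v)
        := gramDisc ℙ (diffGram ℙ P Q) :* evalF ℙ (pencil ℙ s t P Q) v)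
    refl s t p₀ p₁ p₂ q₀ q₁ q₂ v₁ v₂

  -- The bilinear form (u , v) ↦ B_h(u , adj v) is symmetric because h lies in the
  -- pencil of P and Q; it has Gram matrix twistGram h (diffGram P Q).
  bilinear-polarGram-adjugate : ∀ s t P Q u v →
    let h = pencil R s t P Q; g = diffGram R P Q in
    bilinear R (polarGram R h) u (adjugate R g v) ≈ bilinear R (twistGram R h g) u v
  bilinear-polarGram-adjugate s t (p₀ , p₁ , p₂) (q₀ , q₁ , q₂) (u₁ , u₂) (v₁ , v₂) = solve 12
    (λ s t p₀ p₁ p₂ q₀ q₁ q₂ u₁ u₂ v₁ v₂ →
      let ℙ = polynomialRing 12; u = (u₁ , u₂); v = (v₁ , v₂)
          h = pencil ℙ s t (p₀ , p₁ , p₂) (q₀ , q₁ , q₂); g = diffGram ℙ (p₀ , p₁ , p₂) (q₀ , q₁ , q₂) in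
      bilinear ℙ (polarGram ℙ h) u (adjugate ℙ g v) := bilinear ℙ (twistGram ℙ h g) u v)
    refl s t p₀ p₁ p₂ q₀ q₁ q₂ u₁ u₂ v₁ v₂

  Res-linProd : ∀ r₁ r₂ s₁ s₂ →
    Res R r₁ r₂ s₁ s₂ ≈ gramDisc R (diffGram R (linProd R r₁ r₂) (linProd R s₁ s₂))
  Res-linProd (a₁ , b₁) (a₂ , b₂) (c₁ , d₁) (c₂ , d₂) = solve 8
    (λ a₁ b₁ a₂ b₂ c₁ d₁ c₂ d₂ →
      let ℙ = polynomialRing 8; r₁ = (a₁ , b₁); r₂ = (a₂ , b₂); s₁ = (c₁ , d₁); s₂ = (c₂ , d₂) in
      Res ℙ r₁ r₂ s₁ s₂ := gramDisc ℙ (diffGram ℙ (linProd ℙ r₁ r₂) (linProd ℙ s₁ s₂)))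
    refl a₁ b₁ a₂ b₂ c₁ d₁ c₂ d₂

  bilinear-polarGram-Dform : ∀ P Q u v →
    bilinear R (polarGram R (Dform R P Q)) u v ≈ two R * bilinear R (diffGram R P Q) u v
  bilinear-polarGram-Dform (p₀ , p₁ , p₂) (q₀ , q₁ , q₂) (u₁ , u₂) (v₁ , v₂) = solve 10
    (λ p₀ p₁ p₂ q₀ q₁ q₂ u₁ u₂ v₁ v₂ →
      let ℙ = polynomialRing 10; P = (p₀ , p₁ , p₂); Q = (q₀ , q₁ , q₂); u = (u₁ , u₂); v = (v₁ , v₂) in
      bilinear ℙ (polarGram ℙ (Dform ℙ P Q)) u v := two ℙ :* bilinear ℙ (diffGram ℙ P Q) u v)
    refl p₀ p₁ p₂ q₀ q₁ q₂ u₁ u₂ v₁ v₂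

  bilinear-polarGram-roots : ∀ k e₁ e₂ →
    bilinear R (polarGram R (scaleF R k (linProd R e₁ e₂))) e₁ e₂ ≈ - (k * (det R e₁ e₂ * det R e₁ e₂))
  bilinear-polarGram-roots k (η₁ , θ₁) (η₂ , θ₂) = solve 5
    (λ k η₁ θ₁ η₂ θ₂ →
      let ℙ = polynomialRing 5; e₁ = (η₁ , θ₁); e₂ = (η₂ , θ₂) in
      bilinear ℙ (polarGram ℙ (scaleF ℙ k (linProd ℙ e₁ e₂))) e₁ e₂ := :- (k :* (det ℙ e₁ e₂ :* det ℙ e₁ e₂)))
    refl k η₁ θ₁ η₂ θ₂

  linProd-symTensor : ∀ e₁ e₂ → let (a , m , b) = symTensor R e₁ e₂ in
    _≈F_ R (linProd R e₁ e₂) (b , - m , a)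
  linProd-symTensor (η₁ , θ₁) (η₂ , θ₂) =
      refl
    , solve 4 (λ η₁ θ₁ η₂ θ₂ → θ₁ :* (:- η₂) :+ (:- η₁) :* θ₂ := :- (η₁ :* θ₂ :+ θ₁ :* η₂))
        refl η₁ θ₁ η₂ θ₂
    , solve 2 (λ η₁ η₂ → (:- η₁) :* (:- η₂) := η₁ :* η₂) refl η₁ η₂

module _ {c ℓ} (R : CommutativeRing c ℓ) where
  open CommutativeRing R
  open import Algebra.Properties.Group +-group
    using (x∙y⁻¹≈ε⇒x≈y; x≈y⇒x∙y⁻¹≈ε; //-cong₂; ε⁻¹≈ε; ⁻¹-injective)
  open import Relation.Binary.Reasoning.Setoid setoid

  ≈F-sym : ∀ {f g} → _≈F_ R f g → _≈F_ R g f
  ≈F-sym (e₀ , e₁ , e₂) = sym e₀ , sym e₁ , sym e₂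

  ≈F-trans : ∀ {f g h} → _≈F_ R f g → _≈F_ R g h → _≈F_ R f h
  ≈F-trans (e₀ , e₁ , e₂) (e₀′ , e₁′ , e₂′) = trans e₀ e₀′ , trans e₁ e₁′ , trans e₂ e₂′

  -x≈0⇒x≈0 : ∀ {x} → - x ≈ 0# → x ≈ 0#
  -x≈0⇒x≈0 -x≈0 = ⁻¹-injective (trans -x≈0 (sym ε⁻¹≈ε))

  ProjEq⇒det≈0 : ∀ {u v} → ProjEq R u v → det R u v ≈ 0#
  ProjEq⇒det≈0 {u} {v} u~v = x≈y⇒x∙y⁻¹≈ε (trans u~v (*-comm (proj₁ v) (proj₂ u)))

  det≈0⇒ProjEq : ∀ {u v} → det R u v ≈ 0# → ProjEq R u v
  det≈0⇒ProjEq {u} {v} det≈0 = trans (x∙y⁻¹≈ε⇒x≈y _ _ det≈0) (*-comm (proj₂ u) (proj₁ v))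

  bilinear-polarGram-cong : ∀ {f f′} → _≈F_ R f f′ → ∀ u v →
    bilinear R (polarGram R f) u v ≈ bilinear R (polarGram R f′) u v
  bilinear-polarGram-cong (e₀ , e₁ , e₂) u v =
    +-cong (+-cong (*-congʳ (*-congˡ e₀)) (*-congʳ e₁)) (*-congʳ (*-congˡ e₂))

  diffGram-cong : ∀ {P P′ Q Q′} → _≈F_ R P P′ → _≈F_ R Q Q′ →
    _≈F_ R (diffGram R P Q) (diffGram R P′ Q′)
  diffGram-cong (p₀ , p₁ , p₂) (q₀ , q₁ , q₂) =
      //-cong₂ (*-cong p₀ q₁) (*-cong p₁ q₀)
    , //-cong₂ (*-cong p₀ q₂) (*-cong p₂ q₀)
    , //-cong₂ (*-cong p₁ q₂) (*-cong p₂ q₁)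

  gramDisc-cong : ∀ {g g′} → _≈F_ R g g′ → gramDisc R g ≈ gramDisc R g′
  gramDisc-cong (g₀ , g₁ , g₂) = //-cong₂ (*-cong g₁ g₁) (*-cong g₀ g₂)

  bilinear-polarGram²-ProjEq : ∀ h u v → det R u v ≈ 0# →
    bilinear R (polarGram R h) u v * bilinear R (polarGram R h) u v
      ≈ two R * two R * (evalF R h u * evalF R h v)
  bilinear-polarGram²-ProjEq h u v det≈0 = begin
    bilinear R (polarGram R h) u v * bilinear R (polarGram R h) u v
      ≈⟨ bilinear-polarGram² R h u v ⟩
    two R * two R * (evalF R h u * evalF R h v) + disc R h * (det R u v * det R u v)
      ≈⟨ +-congˡ (trans (*-congˡ (trans (*-congʳ det≈0) (zeroˡ _))) (zeroʳ _)) ⟩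
    two R * two R * (evalF R h u * evalF R h v) + 0#
      ≈⟨ +-identityʳ _ ⟩
    two R * two R * (evalF R h u * evalF R h v) ∎

  -- At the two roots of D_{P,Q} only the cross term of its polarisation survives.
  diffGram-at-roots : ∀ P Q k e₁ e₂ → _≈F_ R (Dform R P Q) (scaleF R k (linProd R e₁ e₂)) →
    two R * bilinear R (diffGram R P Q) e₁ e₂ ≈ - (k * (det R e₁ e₂ * det R e₁ e₂))
  diffGram-at-roots P Q k e₁ e₂ D≈ = begin
    two R * bilinear R (diffGram R P Q) e₁ e₂                      ≈⟨ bilinear-polarGram-Dform R P Q e₁ e₂ ⟨
    bilinear R (polarGram R (Dform R P Q)) e₁ e₂                   ≈⟨ bilinear-polarGram-cong D≈ e₁ e₂ ⟩
    bilinear R (polarGram R (scaleF R k (linProd R e₁ e₂))) e₁ e₂  ≈⟨ bilinear-polarGram-roots R k e₁ e₂ ⟩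
    - (k * (det R e₁ e₂ * det R e₁ e₂))                            ∎

module _ {c ℓ} (F : Field c ℓ) where
  open Field F
  open import Relation.Binary.Reasoning.Setoid setoid

  x*y≈0⇒y≈0 : ∀ {x y} → ¬ x ≈ 0# → x * y ≈ 0# → y ≈ 0#
  x*y≈0⇒y≈0 {x} {y} x≉0 xy≈0 with inverse x x≉0
  ... | x⁻¹ , xx⁻¹≈1 = begin
    y                ≈⟨ *-identityˡ y ⟨
    1# * y           ≈⟨ *-congʳ xx⁻¹≈1 ⟨
    (x * x⁻¹) * y    ≈⟨ *-congʳ (*-comm x x⁻¹) ⟩
    (x⁻¹ * x) * y    ≈⟨ *-assoc x⁻¹ x y ⟩
    x⁻¹ * (x * y)    ≈⟨ *-congˡ xy≈0 ⟩
    x⁻¹ * 0#         ≈⟨ zeroʳ x⁻¹ ⟩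
    0#               ∎

  module _ (P Q : Form commutativeRing) where
    private
      R = commutativeRing
      Fⁿ = Fiter R P Q

    ProjEq-Fmap : ∀ {u v} → ProjEq R u v → ProjEq R (Fmap R P Q u) (Fmap R P Q v)
    ProjEq-Fmap {u} {v} u~v = det≈0⇒ProjEq R (begin
      det R (Fmap R P Q u) (Fmap R P Q v)          ≈⟨ det-Fmap R P Q u v ⟩
      det R u v * bilinear R (diffGram R P Q) u v  ≈⟨ *-congʳ (ProjEq⇒det≈0 R u~v) ⟩
      0# * bilinear R (diffGram R P Q) u v         ≈⟨ zeroˡ _ ⟩
      0#                                           ∎)

    ProjEq-Fiter : ∀ {m n} e₁ e₂ → m ≤′ n → ProjEq R (Fⁿ m e₁) (Fⁿ m e₂) → ProjEq R (Fⁿ n e₁) (Fⁿ n e₂)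
    ProjEq-Fiter e₁ e₂ (≤′-reflexive ≡.refl) = id
    ProjEq-Fiter e₁ e₂ (≤′-step m≤n)         = ProjEq-Fmap ∘ ProjEq-Fiter e₁ e₂ m≤n

    bilinear-diffGram≈0 : ∀ {u v} → ProjEq R (Fmap R P Q u) (Fmap R P Q v) → ¬ ProjEq R u v →
      bilinear R (diffGram R P Q) u v ≈ 0#
    bilinear-diffGram≈0 {u} {v} Fu~Fv u≁v =
      x*y≈0⇒y≈0 (u≁v ∘ det≈0⇒ProjEq R) (trans (sym (det-Fmap R P Q u v)) (ProjEq⇒det≈0 R Fu~Fv))

    Fmap-separates-roots : ∀ {k e₁ e₂} → ¬ k ≈ 0# → _≈F_ R (Dform R P Q) (scaleF R k (linProd R e₁ e₂)) →
      ¬ ProjEq R e₁ e₂ → ¬ ProjEq R (Fmap R P Q e₁) (Fmap R P Q e₂)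
    Fmap-separates-roots {k} {e₁} {e₂} k≉0 D≈ e₁≁e₂ Fe₁~Fe₂ =
      det≉0 (x*y≈0⇒y≈0 det≉0 (x*y≈0⇒y≈0 k≉0 (-x≈0⇒x≈0 R (begin
        - (k * (det R e₁ e₂ * det R e₁ e₂))        ≈⟨ diffGram-at-roots R P Q k e₁ e₂ D≈ ⟨
        two R * bilinear R (diffGram R P Q) e₁ e₂  ≈⟨ *-congˡ (bilinear-diffGram≈0 Fe₁~Fe₂ e₁≁e₂) ⟩
        two R * 0#                                 ≈⟨ zeroʳ _ ⟩
        0#                                         ∎))))
      where
      det≉0 : ¬ det R e₁ e₂ ≈ 0#
      det≉0 = e₁≁e₂ ∘ det≈0⇒ProjEq R

module _ {c ℓ c′ ℓ′} {K : Field c ℓ} (E : FieldExtension K c′ ℓ′) where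
  open FieldExtension E
  private
    module K = Field K
    KR = K.commutativeRing
    LR = Field.commutativeRing L
  open Field L
  open RingMorphisms.IsRingMonomorphism isRingMonomorphism
    using (⟦⟧-cong; +-homo; *-homo; -‿homo; 0#-homo; 1#-homo; injective)
  open IntegerCoefficients LR using (Polynomial; ⟦_⟧; close; ⟦⟧-closed; solve; _:=_; _:*_)
  open import Algebra.Properties.Ring ring using (-‿involutive)
  open import Algebra.Properties.CommutativeSemigroup *-commutativeSemigroup using (interchange)
  open import Relation.Binary.Reasoning.Setoid setoid

  InK : Carrier → Set (c ⊔ ℓ′)
  InK x = ∃ λ k → ι k ≈ x

  InK-resp : ∀ {x y} → x ≈ y → InK x → InK y
  InK-resp x≈y (k , ιk≈x) = k , trans ιk≈x x≈y

  InK-ι : ∀ k → InK (ι k)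
  InK-ι k = k , refl

  InK-+ : ∀ {x y} → InK x → InK y → InK (x + y)
  InK-+ (a , ιa≈x) (b , ιb≈y) = a K.+ b , trans (+-homo a b) (+-cong ιa≈x ιb≈y)

  InK-* : ∀ {x y} → InK x → InK y → InK (x * y)
  InK-* (a , ιa≈x) (b , ιb≈y) = a K.* b , trans (*-homo a b) (*-cong ιa≈x ιb≈y)

  InK-neg : ∀ {x} → InK x → InK (- x)
  InK-neg (a , ιa≈x) = K.- a , trans (-‿homo a) (-‿cong ιa≈x)

  InK-neg⁻¹ : ∀ {x} → InK (- x) → InK x
  InK-neg⁻¹ = InK-resp (-‿involutive _) ∘ InK-neg

  InK-poly : ∀ n (f : N-ary n (Polynomial n) (Polynomial n)) {ρ} → All InK ρ → InK (⟦ close n f ⟧ ρ)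
  InK-poly n f = ⟦⟧-closed (InK-resp 0#-homo (InK-ι K.0#)) (InK-resp 1#-homo (InK-ι K.1#))
                           InK-+ InK-* InK-neg (close n f)

  InK-÷ : ∀ {k x} → ¬ k K.≈ K.0# → InK (ι k * x) → InK x
  InK-÷ {k} {x} k≉0 (a , ιa≈kx) with K.inverse k k≉0
  ... | k⁻¹ , kk⁻¹≈1 = k⁻¹ K.* a , (begin
    ι (k⁻¹ K.* a)          ≈⟨ *-homo k⁻¹ a ⟩
    ι k⁻¹ * ι a            ≈⟨ *-congˡ ιa≈kx ⟩
    ι k⁻¹ * (ι k * x)      ≈⟨ *-assoc _ _ _ ⟨
    (ι k⁻¹ * ι k) * x      ≈⟨ *-congʳ (*-homo k⁻¹ k) ⟨
    ι (k⁻¹ K.* k) * x      ≈⟨ *-congʳ (⟦⟧-cong (K.trans (K.*-comm k⁻¹ k) kk⁻¹≈1)) ⟩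
    ι K.1# * x             ≈⟨ *-congʳ 1#-homo ⟩
    1# * x                 ≈⟨ *-identityˡ x ⟩
    x                      ∎)

  ι-≉0 : ∀ {k} → ¬ k K.≈ K.0# → ¬ ι k ≈ 0#
  ι-≉0 k≉0 ιk≈0 = k≉0 (injective (trans ιk≈0 (sym 0#-homo)))

  ι-two : ι (two KR) ≈ two LR
  ι-two = trans (+-homo K.1# K.1#) (+-cong 1#-homo 1#-homo)

  ι-minus-product : ∀ a b c d → ι (a K.* b K.- c K.* d) ≈ ι a * ι b - ι c * ι d
  ι-minus-product a b c d = trans (+-homo _ _) (+-cong (*-homo a b) (trans (-‿homo _) (-‿cong (*-homo c d))))

  ιF-Dform : ∀ P Q → _≈F_ LR (ιF E (Dform KR P Q)) (Dform LR (ιF E P) (ιF E Q))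
  ιF-Dform (p₀ , p₁ , p₂) (q₀ , q₁ , q₂) =
      ι-minus-product p₀ q₁ p₁ q₀
    , trans (*-homo _ _) (*-cong ι-two (ι-minus-product p₀ q₂ p₂ q₀))
    , ι-minus-product p₁ q₂ p₂ q₁

  InKSquares-resp : ∀ {x y} → x ≈ y → InKSquares E x → InKSquares E y
  InKSquares-resp x≈y (k , ιkk≈x) = k , trans ιkk≈x x≈y

  InKSquares-of-square : ¬ two KR K.≈ K.0# → ∀ {g x} → InK g → g * g ≈ two LR * two LR * x → InKSquares E x
  InKSquares-of-square two≉0 {g} {x} (k , ιk≈g) gg≈4x with K.inverse (two KR) two≉0
  ... | half , two·half≈1 = half K.* k , (begin
    ι ((half K.* k) K.* (half K.* k))        ≈⟨ *-homo _ _ ⟩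
    ι (half K.* k) * ι (half K.* k)          ≈⟨ *-cong (*-homo half k) (*-homo half k) ⟩
    (ι half * ι k) * (ι half * ι k)          ≈⟨ *-cong (*-congˡ ιk≈g) (*-congˡ ιk≈g) ⟩
    (ι half * g) * (ι half * g)              ≈⟨ interchange _ _ _ _ ⟩
    (ι half * ι half) * (g * g)              ≈⟨ *-congˡ gg≈4x ⟩
    (ι half * ι half) * (two LR * two LR * x)
      ≈⟨ solve 3 (λ h t x → (h :* h) :* (t :* t :* x) := (t :* h) :* (t :* h) :* x) refl (ι half) (two LR) x ⟩
    (two LR * ι half) * (two LR * ι half) * x ≈⟨ *-congʳ (*-cong two·ι-half≈1 two·ι-half≈1) ⟩
    1# * 1# * x                              ≈⟨ *-congʳ (*-identityˡ 1#) ⟩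
    1# * x                                   ≈⟨ *-identityˡ x ⟩
    x                                        ∎)
    where
    two·ι-half≈1 : two LR * ι half ≈ 1#
    two·ι-half≈1 = trans (*-congʳ (sym ι-two)) (trans (sym (*-homo _ _)) (trans (⟦⟧-cong two·half≈1) 1#-homo))

  SymInK : Pt LR → Pt LR → Set (c ⊔ ℓ′)
  SymInK u v = let (a , m , b) = symTensor LR u v in InK a × InK m × InK b

  SymInK-roots : ∀ {D k e₁ e₂} → ¬ k K.≈ K.0# →
    _≈F_ LR (ιF E D) (scaleF LR (ι k) (linProd LR e₁ e₂)) → SymInK e₁ e₂
  SymInK-roots {e₁ = e₁} {e₂} k≉0 (D₀≈ , D₁≈ , D₂≈) =
    let (l₀ , l₁ , l₂) = linProd-symTensor LR e₁ e₂
    in  InK-÷ k≉0 (InK-resp (trans D₂≈ (*-congˡ l₂)) (InK-ι _))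
      , InK-neg⁻¹ (InK-÷ k≉0 (InK-resp (trans D₁≈ (*-congˡ l₁)) (InK-ι _)))
      , InK-÷ k≉0 (InK-resp (trans D₀≈ (*-congˡ l₀)) (InK-ι _))

module _ {c ℓ c′ ℓ′} {K : Field c ℓ} (E : FieldExtension K c′ ℓ′)
         (P Q : Form (Field.commutativeRing K)) where
  open FieldExtension E
  private
    module K = Field K
    KR = K.commutativeRing
    LR = Field.commutativeRing L
    P′ = ιF E P
    Q′ = ιF E Q
    Fⁿ = Fiter LR P′ Q′
  open Field L
  open IntegerCoefficients LR using (polynomialRing)
  open import Algebra.Properties.CommutativeSemigroup *-commutativeSemigroup using (x∙yz≈y∙xz)
  open import Relation.Binary.Reasoning.Setoid setoid

  InK-PQ : ∀ {n} {ρ : Vec Carrier n} → All (InK E) ρ →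
    All (InK E) (ι (proj₁ P) ∷ ι (proj₁ (proj₂ P)) ∷ ι (proj₂ (proj₂ P))
                ∷ ι (proj₁ Q) ∷ ι (proj₁ (proj₂ Q)) ∷ ι (proj₂ (proj₂ Q)) ∷ ρ)
  InK-PQ ρ∈ = InK-ι E _ ∷ InK-ι E _ ∷ InK-ι E _ ∷ InK-ι E _ ∷ InK-ι E _ ∷ InK-ι E _ ∷ ρ∈

  SymInK-Fmap : ∀ {u v} → SymInK E u v → SymInK E (Fmap LR P′ Q′ u) (Fmap LR P′ Q′ v)
  SymInK-Fmap {u} {v} (a∈ , m∈ , b∈) =
    let (PP≈ , PQ≈ , QQ≈) = symTensor-Fmap LR P′ Q′ u v
        t∈ = InK-PQ (a∈ ∷ m∈ ∷ b∈ ∷ [])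
    in  InK-resp E (sym PP≈) (InK-poly E 9 (λ p₀ p₁ p₂ q₀ q₁ q₂ a m b →
          productOnTensor (polynomialRing 9) (p₀ , p₁ , p₂) (a , m , b)) t∈)
      , InK-resp E (sym PQ≈) (InK-poly E 9 (λ p₀ p₁ p₂ q₀ q₁ q₂ a m b →
          productSumOnTensor (polynomialRing 9) (p₀ , p₁ , p₂) (q₀ , q₁ , q₂) (a , m , b)) t∈)
      , InK-resp E (sym QQ≈) (InK-poly E 9 (λ p₀ p₁ p₂ q₀ q₁ q₂ a m b →
          productOnTensor (polynomialRing 9) (q₀ , q₁ , q₂) (a , m , b)) t∈)

  SymInK-Fiter : ∀ {e₁ e₂} → SymInK E e₁ e₂ → ∀ n → SymInK E (Fⁿ n e₁) (Fⁿ n e₂)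
  SymInK-Fiter e∈ zero    = e∈
  SymInK-Fiter e∈ (suc n) = SymInK-Fmap (SymInK-Fiter e∈ n)

  merge-index≥2 : ∀ {k e₁ e₂} → ¬ k K.≈ K.0# →
    _≈F_ LR (ιF E (Dform KR P Q)) (scaleF LR (ι k) (linProd LR e₁ e₂)) → ∀ m →
    ProjEq LR (Fⁿ (suc m) e₁) (Fⁿ (suc m) e₂) → ¬ ProjEq LR (Fⁿ m e₁) (Fⁿ m e₂) → 2 ≤ suc m
  merge-index≥2 k≉0 D≈ zero    merged separate = ⊥-elim (Fmap-separates-roots L P′ Q′ (ι-≉0 E k≉0)
    (≈F-trans LR (≈F-sym LR (ιF-Dform E P Q)) D≈) separate merged)
  merge-index≥2 k≉0 D≈ (suc m) _      _        = s≤s (s≤s z≤n)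

  module _ (two≉0 : ¬ two KR K.≈ K.0#) (s t : K.Carrier) where
    private
      H = pencil LR (ι s) (ι t) P′ Q′
      Δ = diffGram LR P′ Q′

    Hn-suc : ∀ n z → Hn LR P′ Q′ (ι s) (ι t) (suc n) z ≈ evalF LR H (Fⁿ n z)
    Hn-suc n z = sym (evalF-pencil LR (ι s) (ι t) P′ Q′ (Fⁿ n z))

    ProjEq⇒InKSquares : ∀ {u v} → ProjEq LR u v → SymInK E u v →
      InKSquares E (evalF LR H u * evalF LR H v)
    ProjEq⇒InKSquares {u} {v} u~v (a∈ , m∈ , b∈) =
      InKSquares-of-square E two≉0 polar∈K (bilinear-polarGram²-ProjEq LR H u v (ProjEq⇒det≈0 LR u~v))
      where
      polar∈K : InK E (bilinear LR (polarGram LR H) u v)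
      polar∈K = InK-poly E 11 (λ p₀ p₁ p₂ q₀ q₁ q₂ s t a m b → let ℙ = polynomialRing 11 in
          pairing ℙ (polarGram ℙ (pencil ℙ s t (p₀ , p₁ , p₂) (q₀ , q₁ , q₂))) (a , m , b))
        (InK-PQ (InK-ι E s ∷ InK-ι E t ∷ a∈ ∷ m∈ ∷ b∈ ∷ []))

    merge⇒InKSquares-Res : ∀ {u v} → ProjEq LR (Fmap LR P′ Q′ u) (Fmap LR P′ Q′ v) → ¬ ProjEq LR u v →
      SymInK E u v → ∀ {r₁ r₂ s₁ s₂} →
      _≈F_ LR P′ (linProd LR r₁ r₂) → _≈F_ LR Q′ (linProd LR s₁ s₂) →
      InKSquares E (Res LR r₁ r₂ s₁ s₂ * (evalF LR H u * evalF LR H v))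
    merge⇒InKSquares-Res {u} {v} Fu~Fv u≁v (a∈ , m∈ , b∈) {r₁} {r₂} {s₁} {s₂} P≈ Q≈ =
      InKSquares-of-square E two≉0 polar∈K (begin
        bilinear LR (polarGram LR H) u w * bilinear LR (polarGram LR H) u w
          ≈⟨ bilinear-polarGram²-ProjEq LR H u w u~w ⟩
        two LR * two LR * (evalF LR H u * evalF LR H w)
          ≈⟨ *-congˡ (*-congˡ (evalF-pencil-adjugate LR (ι s) (ι t) P′ Q′ v)) ⟩
        two LR * two LR * (evalF LR H u * (gramDisc LR Δ * evalF LR H v))
          ≈⟨ *-congˡ (x∙yz≈y∙xz _ _ _) ⟩
        two LR * two LR * (gramDisc LR Δ * (evalF LR H u * evalF LR H v))
          ≈⟨ *-congˡ (*-congʳ Res≈) ⟨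
        two LR * two LR * (Res LR r₁ r₂ s₁ s₂ * (evalF LR H u * evalF LR H v)) ∎)
      where
      w = adjugate LR Δ v

      u~w : det LR u w ≈ 0#
      u~w = trans (det-adjugate LR Δ u v) (bilinear-diffGram≈0 L P′ Q′ Fu~Fv u≁v)

      polar∈K : InK E (bilinear LR (polarGram LR H) u w)
      polar∈K = InK-resp E (sym (bilinear-polarGram-adjugate LR (ι s) (ι t) P′ Q′ u v))
        (InK-poly E 11 (λ p₀ p₁ p₂ q₀ q₁ q₂ s t a m b →
            let ℙ = polynomialRing 11; P = (p₀ , p₁ , p₂); Q = (q₀ , q₁ , q₂) in
            pairing ℙ (twistGram ℙ (pencil ℙ s t P Q) (diffGram ℙ P Q)) (a , m , b))
          (InK-PQ (InK-ι E s ∷ InK-ι E t ∷ a∈ ∷ m∈ ∷ b∈ ∷ [])))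

      Res≈ : Res LR r₁ r₂ s₁ s₂ ≈ gramDisc LR Δ
      Res≈ = trans (Res-linProd LR r₁ r₂ s₁ s₂)
                   (gramDisc-cong LR (diffGram-cong LR (≈F-sym LR P≈) (≈F-sym LR Q≈)))

    Hn-InKSquares-after-merge : ∀ {e₁ e₂} → SymInK E e₁ e₂ → ∀ {l n} → l ℕ.< n →
      ProjEq LR (Fⁿ l e₁) (Fⁿ l e₂) →
      InKSquares E (Hn LR P′ Q′ (ι s) (ι t) n e₁ * Hn LR P′ Q′ (ι s) (ι t) n e₂)
    Hn-InKSquares-after-merge {e₁} {e₂} e∈ {n = suc n} (s≤s l≤n) merged =
      InKSquares-resp E (sym (*-cong (Hn-suc n e₁) (Hn-suc n e₂)))
        (ProjEq⇒InKSquares (ProjEq-Fiter L P′ Q′ e₁ e₂ (ℕ.≤⇒≤′ l≤n) merged) (SymInK-Fiter e∈ n))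

    Hn-InKSquares-Res-at-merge : ∀ {e₁ e₂} → SymInK E e₁ e₂ → ∀ m →
      ProjEq LR (Fⁿ (suc m) e₁) (Fⁿ (suc m) e₂) → ¬ ProjEq LR (Fⁿ m e₁) (Fⁿ m e₂) →
      ∀ {r₁ r₂ s₁ s₂} → _≈F_ LR P′ (linProd LR r₁ r₂) → _≈F_ LR Q′ (linProd LR s₁ s₂) →
      InKSquares E (Res LR r₁ r₂ s₁ s₂
                    * (Hn LR P′ Q′ (ι s) (ι t) (suc m) e₁ * Hn LR P′ Q′ (ι s) (ι t) (suc m) e₂))
    Hn-InKSquares-Res-at-merge {e₁} {e₂} e∈ m merged separate P≈ Q≈ =
      InKSquares-resp E (*-congˡ (sym (*-cong (Hn-suc m e₁) (Hn-suc m e₂))))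
        (merge⇒InKSquares-Res merged separate (SymInK-Fiter e∈ m) P≈ Q≈)

-- Opened only here, where it no longer clashes with the ring addition of the modules above.
open import Data.Nat using (_+_)

theorem3p6 : ∀ {c ℓ c′ ℓ′ : Level} (K : Field c ℓ) (E : FieldExtension K c′ ℓ′) →
    let L = FieldExtension.L E
        ι = FieldExtension.ι E
        KR = Field.commutativeRing K
        LR = Field.commutativeRing L
        _≈K_ = Field._≈_ K
        _+K_ = Field._+_ K
        1K = Field.1# K
        0K = Field.0# K
        _≈L_ = Field._≈_ L
        _*L_ = Field._*_ L
    in
    -- char K ≠ 2
    ¬ ((1K +K 1K) ≈K 0K) →
    -- P , Q : relatively prime homogeneous quadratic forms over K
    (P Q : Form KR) → NonZeroForm KR P → NonZeroForm KR Q →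
    RelativelyPrime KR P Q →
    -- factorizations over L giving Res(P,Q):  P = ∏ (bᵢX - aᵢY), Q = ∏ (dⱼX - cⱼY)
    (r₁ r₂ s₁ s₂ : Pt LR) →
    NonZeroPt LR r₁ → NonZeroPt LR r₂ → NonZeroPt LR s₁ → NonZeroPt LR s₂ →
    _≈F_ LR (ιF E P) (linProd LR r₁ r₂) → _≈F_ LR (ιF E Q) (linProd LR s₁ s₂) →
    -- D_{P,Q} = c (θ₁X - η₁Y)(θ₂X - η₂Y), c ∈ K^×, eᵢ = (ηᵢ , θᵢ)
    (cc : Field.Carrier K) → ¬ (cc ≈K 0K) →
    (e₁ e₂ : Pt LR) → NonZeroPt LR e₁ → NonZeroPt LR e₂ →
    _≈F_ LR (ιF E (Dform KR P Q)) (scaleF LR (ι cc) (linProd LR e₁ e₂)) →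
    -- s₀ , t₀ ∈ K not both zero
    (s₀ t₀ : Field.Carrier K) → ¬ ((s₀ ≈K 0K) × (t₀ ≈K 0K)) →
    -- ℓ ≥ 1 with F^ℓ(e₁) = F^ℓ(e₂) but F^(ℓ-1)(e₁) ≠ F^(ℓ-1)(e₂) in P¹
    (l : ℕ) → 1 ≤ l →
    ProjEq LR (Fiter LR (ιF E P) (ιF E Q) l e₁) (Fiter LR (ιF E P) (ιF E Q) l e₂) →
    ¬ ProjEq LR (Fiter LR (ιF E P) (ιF E Q) (l ∸ 1) e₁)
                (Fiter LR (ιF E P) (ιF E Q) (l ∸ 1) e₂) →
    (2 ≤ l)
    × InKSquares E (Res LR r₁ r₂ s₁ s₂
                     *L (Hn LR (ιF E P) (ιF E Q) (ι s₀) (ι t₀) l e₁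
                     *L Hn LR (ιF E P) (ιF E Q) (ι s₀) (ι t₀) l e₂))
    × (∀ (n : ℕ) → l + 1 ≤ n →
         InKSquares E (Hn LR (ιF E P) (ιF E Q) (ι s₀) (ι t₀) n e₁
                       *L Hn LR (ιF E P) (ιF E Q) (ι s₀) (ι t₀) n e₂))
theorem3p6 K E two≉0 P Q _ _ _ r₁ r₂ s₁ s₂ _ _ _ _ P≈ Q≈ k k≉0 e₁ e₂ _ _ D≈ s₀ t₀ _ zero    () merged separate
theorem3p6 K E two≉0 P Q _ _ _ r₁ r₂ s₁ s₂ _ _ _ _ P≈ Q≈ k k≉0 e₁ e₂ _ _ D≈ s₀ t₀ _ (suc m) _  merged separate =
    merge-index≥2 E P Q k≉0 D≈ m merged separate
  , Hn-InKSquares-Res-at-merge E P Q two≉0 s₀ t₀ roots∈K m merged separate P≈ Q≈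
  , λ n l+1≤n → Hn-InKSquares-after-merge E P Q two≉0 s₀ t₀ roots∈K
                  (≡.subst (_≤ n) (ℕ.+-comm (suc m) 1) l+1≤n) merged
  where
  roots∈K : SymInK E e₁ e₂
  roots∈K = SymInK-roots E k≉0 D≈
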